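{- Let $G=(V,E)$ be a finite graph, $Q$ a set of size $q\geq 1$, and let $X$ be uniformly distributed on $Q^V$ and $Y$ uniformly distributed on $Q^E$, independently. Then, with $s$ an indeterminate, $$(s^2-1)^{|E|-r(E)}\,T\Big(G;s^2,\frac{s^2-1+q}{s^2-1}\Big)=\mathbb{E}\Big[(s-1+q)^{\#\{(v,e)\in H:X_v=Y_e\}}(s-1)^{\#\{(v,e)\in H:X_v\neq Y_e\}}\Big].$$ In particular, $$(s^2-1)^{|E|-r(E)}\,T\Big(G;s^2,\frac{s^2-1+q}{s^2-1}\Big)=q^{ -|E|-|V|}(s-1)^{2|E|}\sum_{y\in Q^E}\prod_{v\in V}\sum_{a\in Q}\Big(\frac{s-1+q}{s-1}\Big)^{\#\{e\ni v:\,y_e=a\}}.$$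
   Context: $T(G;x,y)$ is the Tutte polynomial of $G$. For $A\subseteq E$, $r(A)=|V|-k(V,A)$, where $k(V,A)$ is the number of connected components of the spanning subgraph $(V,A)$. Graphs may have loops and multiple edges; $H=\{(v,e):v\text{ an endpoint of }e\}$ is the set of half-edges (a loop contributes two half-edges at its vertex), and $\#\{e\ni v:y_e=a\}$ counts half-edges $(v,e)$ at $v$ with $y_e=a$. -}

module Defs where

open import Data.Nat as ℕ using (ℕ; zero; suc; _∸_)
open import Data.Nat.Properties using (m^n≢0)
open import Data.Fin using (Fin; zero; suc)
open import Data.Bool using (Bool; true; false; if_then_else_; _∧_)
open import Data.Product using (Σ; _×_; _,_; proj₁; proj₂; ∃)
open import Data.Integer using (+_)
open import Data.Rational using (ℚ; _+_; _*_; _-_; 0ℚ; 1ℚ; _/_)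
open import Relation.Binary.PropositionalEquality using (_≡_)
open import Relation.Nullary using (does)
open import Function.Bundles using (_⇔_)
import Data.Fin as F

-- The half-edges of e are
-- (end₁ e , e) and (end₂ e , e); a loop thus gives two half-edges.

record Graph : Set where
  field
    n    : ℕ
    m    : ℕ
    end₁ : Fin m → Fin n
    end₂ : Fin m → Fin n
open Graph public

EdgeSet : Graph → Set
EdgeSet G = Fin (m G) → Bool

data Reach (G : Graph) (A : EdgeSet G) : Fin (n G) → Fin (n G) → Set where
  here  : ∀ {v} → Reach G A v v
  step₁ : ∀ {u} e → A e ≡ true → Reach G A (end₁ G e) u → Reach G A (end₂ G e) u
  step₂ : ∀ {u} e → A e ≡ true → Reach G A (end₂ G e) u → Reach G A (end₁ G e) u

NumComponents : (G : Graph) → EdgeSet G → ℕ → Set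
NumComponents G A k =
  Σ (Fin (n G) → Fin k) λ c →
    (∀ (i : Fin k) → ∃ λ v → c v ≡ i) ×
    (∀ u v → (c u ≡ c v) ⇔ Reach G A u v)

infixr 8 _^_
_^_ : ℚ → ℕ → ℚ
x ^ zero  = 1ℚ
x ^ suc k = x * (x ^ k)

ℕ→ℚ : ℕ → ℚ
ℕ→ℚ k = (+ k) / 1

invPow : (q : ℕ) → .{{_ : ℕ.NonZero q}} → ℕ → ℚ
invPow q k = (+ 1) / (q ℕ.^ k)
  where instance _ = m^n≢0 q k

[_] : Bool → ℕ
[ true ]  = 1
[ false ] = 0

sumFin : (k : ℕ) → (Fin k → ℚ) → ℚ
sumFin zero    f = 0ℚ
sumFin (suc k) f = f zero + sumFin k (λ i → f (suc i))

prodFin : (k : ℕ) → (Fin k → ℚ) → ℚ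
prodFin zero    f = 1ℚ
prodFin (suc k) f = f zero * prodFin k (λ i → f (suc i))

countFin : (k : ℕ) → (Fin k → ℕ) → ℕ
countFin zero    f = 0
countFin (suc k) f = f zero ℕ.+ countFin k (λ i → f (suc i))

cons : ∀ {A : Set} {k : ℕ} → A → (Fin k → A) → Fin (suc k) → A
cons a g zero    = a
cons a g (suc i) = g i

-- sum over all functions Fin k → A, where A is enumerated by a sum
sumFun : ∀ {A : Set} → (((A → ℚ) → ℚ)) → (k : ℕ) → ((Fin k → A) → ℚ) → ℚ
sumFun sA zero    f = f (λ ())
sumFun sA (suc k) f = sA (λ a → sumFun sA k (λ g → f (cons a g)))

sumBool : (Bool → ℚ) → ℚ
sumBool f = f true + f false

sumMaps : (q k : ℕ) → ((Fin k → Fin q) → ℚ) → ℚ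
sumMaps q = sumFun (sumFin q)

size : (G : Graph) → EdgeSet G → ℕ
size G A = countFin (m G) (λ e → [ A e ])

module _ (G : Graph) (k : EdgeSet G → ℕ) where

  rank : EdgeSet G → ℕ
  rank A = n G ∸ k A

  allE : EdgeSet G
  allE _ = true

  tutte : ℚ → ℚ → ℚ
  tutte x y = sumFun sumBool (m G) λ A →
    ((x - 1ℚ) ^ (rank allE ∸ rank A)) * ((y - 1ℚ) ^ (size G A ∸ rank A))

#agree : (G : Graph) {q : ℕ} → (Fin (n G) → Fin q) → (Fin (m G) → Fin q) → ℕ
#agree G X Y = countFin (m G) λ e →
  [ does (X (end₁ G e) F.≟ Y e) ] ℕ.+ [ does (X (end₂ G e) F.≟ Y e) ]

#disagree : (G : Graph) {q : ℕ} → (Fin (n G) → Fin q) → (Fin (m G) → Fin q) → ℕ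
#disagree G X Y = countFin (m G) λ e →
  [ Data.Bool.not (does (X (end₁ G e) F.≟ Y e)) ] ℕ.+
  [ Data.Bool.not (does (X (end₂ G e) F.≟ Y e)) ]

-- #{ e ∋ v : y_e = a }  (half-edges (v,e) at v with y_e = a)
#at : (G : Graph) {q : ℕ} → (Fin (m G) → Fin q) → Fin (n G) → Fin q → ℕ
#at G Y v a = countFin (m G) λ e →
  [ does (end₁ G e F.≟ v) ∧ does (Y e F.≟ a) ] ℕ.+
  [ does (end₂ G e F.≟ v) ∧ does (Y e F.≟ a) ]

𝔼 : (G : Graph) (q : ℕ) → .{{_ : ℕ.NonZero q}} →
    ((Fin (n G) → Fin q) → (Fin (m G) → Fin q) → ℚ) → ℚ
𝔼 G q f = invPow q (n G ℕ.+ m G) *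
  sumMaps q (n G) (λ x → sumMaps q (m G) (λ y → f x y))

module Submission where

-- Summing the weight over the colour Y_e of one edge e = uv gives
--   Σ_c (s-1+q[X_u=c]) (s-1+q[X_v=c]) = q (s²-1 + q[X_u=X_v]),
-- so the expectation equals q^{-|V|} Σ_X Π_e (s²-1 + q[X_u=X_v]).  Expanding the product over
-- subsets A ⊆ E, the colourings X monochromatic on every edge of A are those constant on the
-- components of (V,A), and there are q^{k(A)} of them.  What remains,
-- q^{-|V|} Σ_A (s²-1)^{|E∖A|} q^{|A|+k(A)}, is the subset expansion of the left-hand side,
-- because y - 1 = q/(s²-1).
-- For the second form write s-1+q = w (s-1): the weight becomes (s-1)^{2|E|} Π_v w^{#{e∋v : Y_e = X_v}},
-- whose sum over X factorises over the vertices.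

open import Defs
open import Data.Nat as ℕ using (ℕ; zero; suc; NonZero; _≤_; _∸_)
import Data.Nat.Properties as ℕ
import Data.Integer as ℤ
open import Data.Integer using () renaming (+_ to pos)
import Data.Integer.Properties as ℤ
open import Data.Rational as ℚ using (ℚ; _+_; _*_; _-_; _÷_; 1/_; 0ℚ; 1ℚ; toℚᵘ)
import Data.Rational.Properties as ℚ
open import Data.Rational.Unnormalised as ℚᵘ using (mkℚᵘ; *≡*; _≃_)
import Data.Rational.Unnormalised.Properties as ℚᵘ
open import Data.Rational.Solver using (module +-*-Solver)
open import Algebra.Bundles using (CommutativeMonoid)
import Algebra.Properties.CommutativeSemigroup as CommSemigroupProperties
open import Data.Fin using (Fin; zero; suc)
open import Data.Fin.Properties using (_≟_; injective⇒≤; suc-injective)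
open import Data.Bool using (Bool; true; false; if_then_else_; _∧_; not)
open import Data.Product using (Σ; _×_; _,_; proj₁; proj₂)
open import Data.Sum as Sum using (_⊎_; inj₁; inj₂)
open import Data.Empty using (⊥-elim)
open import Function.Base using (_∘_)
open import Function.Bundles using (Equivalence; mk⇔)
open import Relation.Nullary using (does; yes; no; ¬_)
open import Relation.Nullary.Decidable using (dec-true; does-⇔)
open import Relation.Binary.PropositionalEquality hiding ([_])

open +-*-Solver using (solve; _:+_; _:*_; _:-_; _:=_; con)

module ℕ+ = CommSemigroupProperties ℕ.+-commutativeSemigroup
module ℚ+ = CommSemigroupProperties (CommutativeMonoid.commutativeSemigroup ℚ.+-0-commutativeMonoid)
module ℚ* = CommSemigroupProperties (CommutativeMonoid.commutativeSemigroup ℚ.*-1-commutativeMonoid)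

toℚᵘ-ℕ→ℚ : ∀ j → toℚᵘ (ℕ→ℚ j) ≃ mkℚᵘ (pos j) 0
toℚᵘ-ℕ→ℚ j = ℚ.toℚᵘ-fromℚᵘ (mkℚᵘ (pos j) 0)

ℕ→ℚ-suc : ∀ k → ℕ→ℚ (suc k) ≡ 1ℚ + ℕ→ℚ k
ℕ→ℚ-suc k = ℚ.toℚᵘ-injective (begin
  toℚᵘ (ℕ→ℚ (suc k))                   ≈⟨ toℚᵘ-ℕ→ℚ (suc k) ⟩
  mkℚᵘ (pos (suc k)) 0                 ≈⟨ *≡* cross-multiplied ⟩
  mkℚᵘ (pos 1) 0 ℚᵘ.+ mkℚᵘ (pos k) 0   ≈⟨ ℚᵘ.+-cong (toℚᵘ-ℕ→ℚ 1) (toℚᵘ-ℕ→ℚ k) ⟨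
  toℚᵘ 1ℚ ℚᵘ.+ toℚᵘ (ℕ→ℚ k)            ≈⟨ ℚ.toℚᵘ-homo-+ 1ℚ (ℕ→ℚ k) ⟨
  toℚᵘ (1ℚ + ℕ→ℚ k)                    ∎)
  where
  open ℚᵘ.≃-Reasoning
  cross-multiplied : pos (suc k) ℤ.* pos 1 ≡ (pos 1 ℤ.* pos 1 ℤ.+ pos k ℤ.* pos 1) ℤ.* pos 1
  cross-multiplied = trans (ℤ.*-identityʳ _)
    (sym (trans (ℤ.*-identityʳ _) (cong (ℤ._+_ (pos 1)) (ℤ.*-identityʳ (pos k)))))

ℕ→ℚ-+ : ∀ a b → ℕ→ℚ (a ℕ.+ b) ≡ ℕ→ℚ a + ℕ→ℚ b
ℕ→ℚ-+ zero    b = sym (ℚ.+-identityˡ (ℕ→ℚ b))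
ℕ→ℚ-+ (suc a) b = begin
  ℕ→ℚ (suc (a ℕ.+ b))        ≡⟨ ℕ→ℚ-suc (a ℕ.+ b) ⟩
  1ℚ + ℕ→ℚ (a ℕ.+ b)         ≡⟨ cong (1ℚ +_) (ℕ→ℚ-+ a b) ⟩
  1ℚ + (ℕ→ℚ a + ℕ→ℚ b)       ≡⟨ ℚ.+-assoc 1ℚ (ℕ→ℚ a) (ℕ→ℚ b) ⟨
  (1ℚ + ℕ→ℚ a) + ℕ→ℚ b       ≡⟨ cong (_+ ℕ→ℚ b) (ℕ→ℚ-suc a) ⟨
  ℕ→ℚ (suc a) + ℕ→ℚ b        ∎
  where open ≡-Reasoning

ℕ→ℚ-* : ∀ a b → ℕ→ℚ (a ℕ.* b) ≡ ℕ→ℚ a * ℕ→ℚ b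
ℕ→ℚ-* zero    b = sym (ℚ.*-zeroˡ (ℕ→ℚ b))
ℕ→ℚ-* (suc a) b = begin
  ℕ→ℚ (b ℕ.+ a ℕ.* b)        ≡⟨ ℕ→ℚ-+ b (a ℕ.* b) ⟩
  ℕ→ℚ b + ℕ→ℚ (a ℕ.* b)      ≡⟨ cong (ℕ→ℚ b +_) (ℕ→ℚ-* a b) ⟩
  ℕ→ℚ b + ℕ→ℚ a * ℕ→ℚ b      ≡⟨ solve 2 (λ a b → b :+ a :* b := (con 1ℚ :+ a) :* b) refl (ℕ→ℚ a) (ℕ→ℚ b) ⟩
  (1ℚ + ℕ→ℚ a) * ℕ→ℚ b       ≡⟨ cong (_* ℕ→ℚ b) (ℕ→ℚ-suc a) ⟨
  ℕ→ℚ (suc a) * ℕ→ℚ b        ∎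
  where open ≡-Reasoning

^-distribˡ-+-* : ∀ x a b → x ^ (a ℕ.+ b) ≡ x ^ a * x ^ b
^-distribˡ-+-* x zero    b = sym (ℚ.*-identityˡ (x ^ b))
^-distribˡ-+-* x (suc a) b =
  trans (cong (x *_) (^-distribˡ-+-* x a b)) (sym (ℚ.*-assoc x (x ^ a) (x ^ b)))

^-distribʳ-* : ∀ x y a → (x * y) ^ a ≡ x ^ a * y ^ a
^-distribʳ-* x y zero    = refl
^-distribʳ-* x y (suc a) = trans (cong ((x * y) *_) (^-distribʳ-* x y a))
  (solve 4 (λ x y p q → (x :* y) :* (p :* q) := (x :* p) :* (y :* q)) refl x y (x ^ a) (y ^ a))

^-zeroˡ : ∀ a → 1ℚ ^ a ≡ 1ℚ
^-zeroˡ zero    = refl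
^-zeroˡ (suc a) = trans (ℚ.*-identityˡ (1ℚ ^ a)) (^-zeroˡ a)

ℕ→ℚ-^ : ∀ q a → ℕ→ℚ (q ℕ.^ a) ≡ ℕ→ℚ q ^ a
ℕ→ℚ-^ q zero    = refl
ℕ→ℚ-^ q (suc a) = trans (ℕ→ℚ-* q (q ℕ.^ a)) (cong (ℕ→ℚ q *_) (ℕ→ℚ-^ q a))

1/ℕ-inverseˡ : ∀ N .{{_ : NonZero N}} → (pos 1 ℚ./ N) * ℕ→ℚ N ≡ 1ℚ
1/ℕ-inverseˡ (suc d) = ℚ.toℚᵘ-injective (begin
  toℚᵘ ((pos 1 ℚ./ suc d) * ℕ→ℚ (suc d))          ≈⟨ ℚ.toℚᵘ-homo-* (pos 1 ℚ./ suc d) (ℕ→ℚ (suc d)) ⟩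
  toℚᵘ (pos 1 ℚ./ suc d) ℚᵘ.* toℚᵘ (ℕ→ℚ (suc d))  ≈⟨ ℚᵘ.*-cong (ℚ.toℚᵘ-fromℚᵘ (mkℚᵘ (pos 1) d)) (toℚᵘ-ℕ→ℚ (suc d)) ⟩
  mkℚᵘ (pos 1) d ℚᵘ.* mkℚᵘ (pos (suc d)) 0        ≈⟨ *≡* cross-multiplied ⟩
  toℚᵘ 1ℚ                                         ∎)
  where
  open ℚᵘ.≃-Reasoning
  cross-multiplied : (pos 1 ℤ.* pos (suc d)) ℤ.* pos 1 ≡ pos 1 ℤ.* pos (suc d ℕ.* 1)
  cross-multiplied = trans (ℤ.*-identityʳ _) (trans (ℤ.*-identityˡ _)
    (sym (trans (ℤ.*-identityˡ _) (cong pos (ℕ.*-identityʳ (suc d))))))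

invPow-inverseˡ : ∀ q .{{_ : NonZero q}} K → invPow q K * ℕ→ℚ q ^ K ≡ 1ℚ
invPow-inverseˡ q K = trans (cong (invPow q K *_) (sym (ℕ→ℚ-^ q K))) (1/ℕ-inverseˡ (q ℕ.^ K) {{ℕ.m^n≢0 q K}})

÷-*-cancel : ∀ p t .{{_ : ℚ.NonZero t}} → (p ÷ t) * t ≡ p
÷-*-cancel p t = trans (ℚ.*-assoc p (1/ t) t) (trans (cong (p *_) (ℚ.*-inverseˡ t)) (ℚ.*-identityʳ p))

𝟙 : Bool → ℚ
𝟙 true  = 1ℚ
𝟙 false = 0ℚ

record Linear {A : Set} (S : (A → ℚ) → ℚ) : Set where
  field
    ext         : ∀ {f g} → (∀ a → f a ≡ g a) → S f ≡ S g
    additive    : ∀ f g → S (λ a → f a + g a) ≡ S f + S g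
    homogeneous : ∀ c f → S (λ a → c * f a) ≡ c * S f

  zero-sum : S (λ _ → 0ℚ) ≡ 0ℚ
  zero-sum = trans (ext (λ _ → sym (ℚ.*-zeroˡ 0ℚ)))
    (trans (homogeneous 0ℚ (λ _ → 0ℚ)) (ℚ.*-zeroˡ (S (λ _ → 0ℚ))))

open Linear public

sumFin-cong : ∀ k {f g : Fin k → ℚ} → (∀ a → f a ≡ g a) → sumFin k f ≡ sumFin k g
sumFin-cong zero    eq = refl
sumFin-cong (suc k) eq = cong₂ _+_ (eq zero) (sumFin-cong k (λ a → eq (suc a)))

sumFin-+ : ∀ k f g → sumFin k (λ a → f a + g a) ≡ sumFin k f + sumFin k g
sumFin-+ zero    f g = sym (ℚ.+-identityˡ 0ℚ)
sumFin-+ (suc k) f g = trans (cong (f zero + g zero +_) (sumFin-+ k (λ i → f (suc i)) (λ i → g (suc i))))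
  (ℚ+.interchange (f zero) (g zero) (sumFin k (λ i → f (suc i))) (sumFin k (λ i → g (suc i))))

sumFin-* : ∀ k c f → sumFin k (λ a → c * f a) ≡ c * sumFin k f
sumFin-* zero    c f = sym (ℚ.*-zeroʳ c)
sumFin-* (suc k) c f = trans (cong (c * f zero +_) (sumFin-* k c (λ i → f (suc i))))
  (sym (ℚ.*-distribˡ-+ c (f zero) (sumFin k (λ i → f (suc i)))))

sumFin-linear : ∀ k → Linear (sumFin k)
sumFin-linear k = record { ext = sumFin-cong k ; additive = sumFin-+ k ; homogeneous = sumFin-* k }

sumBool-linear : Linear sumBool
sumBool-linear = record
  { ext         = λ eq → cong₂ _+_ (eq true) (eq false)
  ; additive    = λ f g → ℚ+.interchange (f true) (g true) (f false) (g false)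
  ; homogeneous = λ c f → sym (ℚ.*-distribˡ-+ c (f true) (f false))
  }

sumFun-linear : ∀ {A} {sA : (A → ℚ) → ℚ} → Linear sA → ∀ n → Linear (sumFun sA n)
sumFun-linear L zero    = record { ext = λ eq → eq _ ; additive = λ f g → refl ; homogeneous = λ c f → refl }
sumFun-linear L (suc n) = record
  { ext         = λ eq → ext L (λ a → ext L′ (λ g → eq (cons a g)))
  ; additive    = λ f g → trans (ext L (λ a → additive L′ (λ x → f (cons a x)) (λ x → g (cons a x))))
                                (additive L _ _)
  ; homogeneous = λ c f → trans (ext L (λ a → homogeneous L′ c (λ x → f (cons a x)))) (homogeneous L c _)
  }
  where L′ = sumFun-linear L n

sumMaps-linear : ∀ q n → Linear (sumMaps q n)
sumMaps-linear q = sumFun-linear (sumFin-linear q)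

Fubini : ∀ {A : Set} → ((A → ℚ) → ℚ) → Set₁
Fubini {A} S = ∀ {B : Set} (T : (B → ℚ) → ℚ) → Linear T → (f : A → B → ℚ) →
  S (λ a → T (f a)) ≡ T (λ b → S (λ a → f a b))

sumFin-fubini : ∀ k → Fubini (sumFin k)
sumFin-fubini zero    T L f = sym (zero-sum L)
sumFin-fubini (suc k) T L f = trans (cong (T (f zero) +_) (sumFin-fubini k T L (λ i → f (suc i))))
  (sym (additive L (f zero) (λ b → sumFin k (λ i → f (suc i) b))))

sumFun-fubini : ∀ {A} {sA : (A → ℚ) → ℚ} → Linear sA → Fubini sA → ∀ n → Fubini (sumFun sA n)
sumFun-fubini L F zero    T LT f = refl
sumFun-fubini {sA = sA} L F (suc n) T LT f =
  trans (ext L (λ a → sumFun-fubini L F n T LT (λ g → f (cons a g))))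
        (F T LT (λ a b → sumFun sA n (λ g → f (cons a g) b)))

sumMaps-fubini : ∀ q n → Fubini (sumMaps q n)
sumMaps-fubini q = sumFun-fubini (sumFin-linear q) (sumFin-fubini q)

prodFin-cong : ∀ k {f g : Fin k → ℚ} → (∀ a → f a ≡ g a) → prodFin k f ≡ prodFin k g
prodFin-cong zero    eq = refl
prodFin-cong (suc k) eq = cong₂ _*_ (eq zero) (prodFin-cong k (λ a → eq (suc a)))

prodFin-* : ∀ k (f g : Fin k → ℚ) → prodFin k (λ a → f a * g a) ≡ prodFin k f * prodFin k g
prodFin-* zero    f g = sym (ℚ.*-identityˡ 1ℚ)
prodFin-* (suc k) f g = trans (cong (f zero * g zero *_) (prodFin-* k (λ i → f (suc i)) (λ i → g (suc i))))
  (ℚ*.interchange (f zero) (g zero) (prodFin k (λ i → f (suc i))) (prodFin k (λ i → g (suc i))))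

prodFin-const : ∀ k c → prodFin k (λ _ → c) ≡ c ^ k
prodFin-const zero    c = refl
prodFin-const (suc k) c = cong (c *_) (prodFin-const k c)

sumFun-prodFin : ∀ {A} {sA : (A → ℚ) → ℚ} → Linear sA → ∀ n (h : Fin n → A → ℚ) →
  sumFun sA n (λ x → prodFin n (λ v → h v (x v))) ≡ prodFin n (λ v → sA (h v))
sumFun-prodFin L zero    h = refl
sumFun-prodFin {sA = sA} L (suc n) h = begin
  sA (λ a → sumFun sA n (λ x → h zero a * prodFin n (λ v → h (suc v) (x v))))
    ≡⟨ ext L (λ a → homogeneous (sumFun-linear L n) (h zero a) _) ⟩
  sA (λ a → h zero a * sumFun sA n (λ x → prodFin n (λ v → h (suc v) (x v))))
    ≡⟨ ext L (λ a → cong (h zero a *_) (sumFun-prodFin L n (λ v → h (suc v)))) ⟩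
  sA (λ a → h zero a * P)
    ≡⟨ ext L (λ a → ℚ.*-comm (h zero a) P) ⟩
  sA (λ a → P * h zero a)
    ≡⟨ homogeneous L P (h zero) ⟩
  P * sA (h zero)
    ≡⟨ ℚ.*-comm P (sA (h zero)) ⟩
  sA (h zero) * P ∎
  where
  open ≡-Reasoning
  P = prodFin n (λ v → sA (h (suc v)))

sumFin-const : ∀ k c → sumFin k (λ _ → c) ≡ ℕ→ℚ k * c
sumFin-const zero    c = sym (ℚ.*-zeroˡ c)
sumFin-const (suc k) c = trans (cong (c +_) (sumFin-const k c))
  (trans (solve 2 (λ c x → c :+ x :* c := (con 1ℚ :+ x) :* c) refl c (ℕ→ℚ k)) (cong (_* c) (sym (ℕ→ℚ-suc k))))

sumMaps-one : ∀ q k → sumMaps q k (λ _ → 1ℚ) ≡ ℕ→ℚ q ^ k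
sumMaps-one q zero    = refl
sumMaps-one q (suc k) = trans (sumFin-cong q (λ _ → sumMaps-one q k)) (sumFin-const q (ℕ→ℚ q ^ k))

sumFin-δ : ∀ q (a : Fin q) (f : Fin q → ℚ) → sumFin q (λ c → 𝟙 (does (a ≟ c)) * f c) ≡ f a
sumFin-δ (suc q) zero f = begin
  1ℚ * f zero + sumFin q (λ c → 0ℚ * f (suc c))  ≡⟨ cong (1ℚ * f zero +_) (sumFin-cong q (λ c → ℚ.*-zeroˡ (f (suc c)))) ⟩
  1ℚ * f zero + sumFin q (λ _ → 0ℚ)              ≡⟨ cong (1ℚ * f zero +_) (zero-sum (sumFin-linear q)) ⟩
  1ℚ * f zero + 0ℚ                               ≡⟨ solve 1 (λ x → con 1ℚ :* x :+ con 0ℚ := x) refl (f zero) ⟩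
  f zero                                         ∎
  where open ≡-Reasoning
sumFin-δ (suc q) (suc a) f = trans (cong (0ℚ * f zero +_) (sumFin-δ q a (λ c → f (suc c))))
  (solve 2 (λ x y → con 0ℚ :* x :+ y := y) refl (f zero) (f (suc a)))

sumFin-δ-one : ∀ q (a : Fin q) → sumFin q (λ c → 𝟙 (does (a ≟ c))) ≡ 1ℚ
sumFin-δ-one q a = trans (sumFin-cong q (λ c → sym (ℚ.*-identityʳ _))) (sumFin-δ q a (λ _ → 1ℚ))

countFin-cong : ∀ k {f g : Fin k → ℕ} → (∀ a → f a ≡ g a) → countFin k f ≡ countFin k g
countFin-cong zero    eq = refl
countFin-cong (suc k) eq = cong₂ ℕ._+_ (eq zero) (countFin-cong k (λ a → eq (suc a)))

countFin-+ : ∀ k (f g : Fin k → ℕ) → countFin k (λ a → f a ℕ.+ g a) ≡ countFin k f ℕ.+ countFin k g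
countFin-+ zero    f g = refl
countFin-+ (suc k) f g =
  trans (cong (f zero ℕ.+ g zero ℕ.+_) (countFin-+ k (λ i → f (suc i)) (λ i → g (suc i))))
        (ℕ+.interchange (f zero) (g zero) (countFin k (λ i → f (suc i))) (countFin k (λ i → g (suc i))))

countFin-const : ∀ k c → countFin k (λ _ → c) ≡ k ℕ.* c
countFin-const zero    c = refl
countFin-const (suc k) c = cong (c ℕ.+_) (countFin-const k c)

countFin-zero : ∀ k → countFin k (λ _ → 0) ≡ 0
countFin-zero k = trans (countFin-const k 0) (ℕ.*-zeroʳ k)

countFin-swap : ∀ a b (f : Fin a → Fin b → ℕ) →
  countFin a (λ i → countFin b (f i)) ≡ countFin b (λ j → countFin a (λ i → f i j))
countFin-swap zero    b f = sym (countFin-zero b)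
countFin-swap (suc a) b f = trans (cong (countFin b (f zero) ℕ.+_) (countFin-swap a b (λ i → f (suc i))))
  (sym (countFin-+ b (f zero) (λ j → countFin a (λ i → f (suc i) j))))

countFin-δ : ∀ n (w : Fin n) (b : Fin n → Bool) → countFin n (λ v → [ does (w ≟ v) ∧ b v ]) ≡ [ b w ]
countFin-δ (suc n) zero    b = trans (cong ([ b zero ] ℕ.+_) (countFin-zero n)) (ℕ.+-identityʳ [ b zero ])
countFin-δ (suc n) (suc w) b = countFin-δ n w (λ v → b (suc v))

^-countFin : ∀ x k (f : Fin k → ℕ) → x ^ countFin k f ≡ prodFin k (λ i → x ^ f i)
^-countFin x zero    f = refl
^-countFin x (suc k) f = trans (^-distribˡ-+-* x (f zero) (countFin k (λ i → f (suc i))))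
  (cong (x ^ f zero *_) (^-countFin x k (λ i → f (suc i))))

allFin : ∀ k → (Fin k → Bool) → Bool
allFin zero    b = true
allFin (suc k) b = b zero ∧ allFin k (λ i → b (suc i))

allFin-lookup : ∀ k (b : Fin k → Bool) → allFin k b ≡ true → ∀ i → b i ≡ true
allFin-lookup (suc k) b eq i with b zero in b₀
allFin-lookup (suc k) b eq zero    | true = b₀
allFin-lookup (suc k) b eq (suc i) | true = allFin-lookup k (λ j → b (suc j)) eq i

allFin-tabulate : ∀ k (b : Fin k → Bool) → (∀ i → b i ≡ true) → allFin k b ≡ true
allFin-tabulate zero    b h = refl
allFin-tabulate (suc k) b h rewrite h zero = allFin-tabulate k (λ j → b (suc j)) (λ j → h (suc j))

𝟙-∧ : ∀ a b → 𝟙 (a ∧ b) ≡ 𝟙 a * 𝟙 b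
𝟙-∧ true  b = sym (ℚ.*-identityˡ (𝟙 b))
𝟙-∧ false b = sym (ℚ.*-zeroˡ (𝟙 b))

prodFin-𝟙 : ∀ k (b : Fin k → Bool) → prodFin k (λ i → 𝟙 (b i)) ≡ 𝟙 (allFin k b)
prodFin-𝟙 zero    b = refl
prodFin-𝟙 (suc k) b = trans (cong (𝟙 (b zero) *_) (prodFin-𝟙 k (λ i → b (suc i)))) (sym (𝟙-∧ (b zero) _))

bool-ext : ∀ {a b : Bool} → (a ≡ true → b ≡ true) → (b ≡ true → a ≡ true) → a ≡ b
bool-ext {true}  a⇒b b⇒a = sym (a⇒b refl)
bool-ext {false} {true}  a⇒b b⇒a = b⇒a refl
bool-ext {false} {false} a⇒b b⇒a = refl

≟-true⇒≡ : ∀ {k} {a b : Fin k} → does (a ≟ b) ≡ true → a ≡ b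
≟-true⇒≡ {a = a} {b} p with a ≟ b
... | yes a≡b = a≡b

≟-sym : ∀ {k} (a b : Fin k) → does (a ≟ b) ≡ does (b ≟ a)
≟-sym a b = does-⇔ (mk⇔ sym sym) (a ≟ b) (b ≟ a)

sumMaps-point : ∀ q n (y : Fin n → Fin q) → sumMaps q n (λ x → prodFin n (λ v → 𝟙 (does (y v ≟ x v)))) ≡ 1ℚ
sumMaps-point q n y = begin
  sumMaps q n (λ x → prodFin n (λ v → 𝟙 (does (y v ≟ x v))))  ≡⟨ sumFun-prodFin (sumFin-linear q) n (λ v a → 𝟙 (does (y v ≟ a))) ⟩
  prodFin n (λ v → sumFin q (λ a → 𝟙 (does (y v ≟ a))))       ≡⟨ prodFin-cong n (λ v → sumFin-δ-one q (y v)) ⟩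
  prodFin n (λ _ → 1ℚ)                                        ≡⟨ prodFin-const n 1ℚ ⟩
  1ℚ ^ n                                                      ≡⟨ ^-zeroˡ n ⟩
  1ℚ                                                          ∎
  where open ≡-Reasoning

prodFin-+ : ∀ k (x y : Fin k → ℚ) →
  prodFin k (λ e → x e + y e) ≡ sumFun sumBool k (λ A → prodFin k (λ e → if A e then y e else x e))
prodFin-+ k x y = trans (prodFin-cong k (λ e → ℚ.+-comm (x e) (y e)))
  (sym (sumFun-prodFin sumBool-linear k (λ e b → if b then y e else x e)))

prodFin-if : ∀ k (A : Fin k → Bool) (a b : ℚ) (w : Fin k → ℚ) →
  prodFin k (λ e → if A e then a * w e else b)
  ≡ b ^ countFin k (λ e → [ not (A e) ]) * (a ^ countFin k (λ e → [ A e ]) * prodFin k (λ e → if A e then w e else 1ℚ))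
prodFin-if zero    A a b w = solve 0 (con 1ℚ := con 1ℚ :* (con 1ℚ :* con 1ℚ)) refl
prodFin-if (suc k) A a b w with A zero | prodFin-if k (λ e → A (suc e)) a b (λ e → w (suc e))
... | true  | ih = trans (cong (a * w zero *_) ih)
  (solve 5 (λ a w b₀ a₀ p → (a :* w) :* (b₀ :* (a₀ :* p)) := b₀ :* ((a :* a₀) :* (w :* p))) refl
    a (w zero) (b ^ countFin k (λ e → [ not (A (suc e)) ])) (a ^ countFin k (λ e → [ A (suc e) ]))
    (prodFin k (λ e → if A (suc e) then w (suc e) else 1ℚ)))
... | false | ih = trans (cong (b *_) ih)
  (solve 4 (λ b b₀ a₀ p → b :* (b₀ :* (a₀ :* p)) := (b :* b₀) :* (a₀ :* (con 1ℚ :* p))) refl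
    b (b ^ countFin k (λ e → [ not (A (suc e)) ])) (a ^ countFin k (λ e → [ A (suc e) ]))
    (prodFin k (λ e → if A (suc e) then w (suc e) else 1ℚ)))

count+count-not : ∀ k (A : Fin k → Bool) → countFin k (λ e → [ A e ]) ℕ.+ countFin k (λ e → [ not (A e) ]) ≡ k
count+count-not k A = begin
  countFin k (λ e → [ A e ]) ℕ.+ countFin k (λ e → [ not (A e) ])  ≡⟨ countFin-+ k _ _ ⟨
  countFin k (λ e → [ A e ] ℕ.+ [ not (A e) ])                      ≡⟨ countFin-cong k (λ e → one (A e)) ⟩
  countFin k (λ _ → 1)                                              ≡⟨ countFin-const k 1 ⟩
  k ℕ.* 1                                                           ≡⟨ ℕ.*-identityʳ k ⟩
  k                                                                 ∎
  where
  open ≡-Reasoning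
  one : ∀ b → [ b ] ℕ.+ [ not b ] ≡ 1
  one true  = refl
  one false = refl

module _ {G : Graph} {A : EdgeSet G} where

  Reach-trans : ∀ {u v w} → Reach G A u v → Reach G A v w → Reach G A u w
  Reach-trans here          r′ = r′
  Reach-trans (step₁ e p r) r′ = step₁ e p (Reach-trans r r′)
  Reach-trans (step₂ e p r) r′ = step₂ e p (Reach-trans r r′)

  Reach-sym : ∀ {u v} → Reach G A u v → Reach G A v u
  Reach-sym here          = here
  Reach-sym (step₁ e p r) = Reach-trans (Reach-sym r) (step₂ e p here)
  Reach-sym (step₂ e p r) = Reach-trans (Reach-sym r) (step₁ e p here)

Reach-mono : ∀ {G : Graph} {A B : EdgeSet G} → (∀ e → A e ≡ true → B e ≡ true) →
  ∀ {u v} → Reach G A u v → Reach G B u v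
Reach-mono A⊆B here          = here
Reach-mono A⊆B (step₁ e p r) = step₁ e (A⊆B e p) (Reach-mono A⊆B r)
Reach-mono A⊆B (step₂ e p r) = step₂ e (A⊆B e p) (Reach-mono A⊆B r)

module Components {G : Graph} {A : EdgeSet G} {k : ℕ} (N : NumComponents G A k) where

  component : Fin (n G) → Fin k
  component = proj₁ N

  representative : Fin k → Fin (n G)
  representative i = proj₁ (proj₁ (proj₂ N) i)

  component-representative : ∀ i → component (representative i) ≡ i
  component-representative i = proj₂ (proj₁ (proj₂ N) i)

  same⇒Reach : ∀ {u v} → component u ≡ component v → Reach G A u v
  same⇒Reach {u} {v} = Equivalence.to (proj₂ (proj₂ N) u v)

  Reach⇒same : ∀ {u v} → Reach G A u v → component u ≡ component v
  Reach⇒same {u} {v} = Equivalence.from (proj₂ (proj₂ N) u v)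

  Reach-representative : ∀ v → Reach G A (representative (component v)) v
  Reach-representative v = same⇒Reach (component-representative (component v))

  Reach-representatives : ∀ {i j} → Reach G A (representative i) (representative j) → i ≡ j
  Reach-representatives {i} {j} r =
    trans (sym (component-representative i)) (trans (Reach⇒same r) (component-representative j))

  representative-injective : ∀ {i j} → representative i ≡ representative j → i ≡ j
  representative-injective {i} eq = Reach-representatives (subst (Reach G A (representative i)) eq here)

components≤vertices : ∀ {G A k} → NumComponents G A k → k ≤ n G
components≤vertices N = injective⇒≤ (Components.representative-injective N)

components-antitone : ∀ {G A B a b} → NumComponents G A a → NumComponents G B b →
  (∀ {u v} → Reach G A u v → Reach G B u v) → b ≤ a
components-antitone {b = b} NA NB A⇒B = injective⇒≤ {f = λ j → A.component (B.representative j)} inj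
  where
  module A = Components NA
  module B = Components NB
  retract : ∀ j → B.component (A.representative (A.component (B.representative j))) ≡ j
  retract j = trans (B.Reach⇒same (A⇒B (A.Reach-representative (B.representative j)))) (B.component-representative j)
  inj : ∀ {x y : Fin b} → A.component (B.representative x) ≡ A.component (B.representative y) → x ≡ y
  inj {x} {y} eq = trans (sym (retract x)) (trans (cong (λ i → B.component (A.representative i)) eq) (retract y))

vertices≤components-of-empty : ∀ {G A k} → (∀ e → A e ≡ false) → NumComponents G A k → n G ≤ k
vertices≤components-of-empty {G} {A} z N = injective⇒≤ (λ eq → trivial (same⇒Reach eq))
  where
  open Components N
  trivial : ∀ {u v} → Reach G A u v → u ≡ v
  trivial here          = refl
  trivial (step₁ e p r) with () ← trans (sym p) (z e)
  trivial (step₂ e p r) with () ← trans (sym p) (z e)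

Near : (G : Graph) → EdgeSet G → Fin (n G) → Fin (n G) → Fin (n G) → Set
Near G A w₁ w₂ x = Reach G A x w₁ ⊎ Reach G A x w₂

components-merge : ∀ {G A B a b} {w₁ w₂ : Fin (n G)} → NumComponents G A a → NumComponents G B b →
  (∀ {u v} → Reach G B u v → Reach G A u v ⊎ (Near G A w₁ w₂ u × Near G A w₁ w₂ v)) → a ≤ suc b
components-merge {G} {A} {B} {a} {b} {w₁} {w₂} NA NB B⇒A = injective⇒≤ {f = φ} φ-injective
  where
  module A = Components NA
  module B = Components NB
  φ : Fin a → Fin (suc b)
  φ i = if does (i ≟ A.component w₁) then zero else suc (B.component (A.representative i))

  away-from-w₁ : ∀ {i} → ¬ i ≡ A.component w₁ → Near G A w₁ w₂ (A.representative i) →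
                 Reach G A (A.representative i) w₂
  away-from-w₁ ne (inj₁ r) = ⊥-elim (ne (trans (sym (A.component-representative _)) (A.Reach⇒same r)))
  away-from-w₁ ne (inj₂ r) = r

  off-w₁ : ∀ {i j} → ¬ i ≡ A.component w₁ → ¬ j ≡ A.component w₁ →
           B.component (A.representative i) ≡ B.component (A.representative j) → i ≡ j
  off-w₁ ni nj eq with B⇒A (B.same⇒Reach eq)
  ... | inj₁ r        = A.Reach-representatives r
  ... | inj₂ (x , y) = A.Reach-representatives (Reach-trans (away-from-w₁ ni x) (Reach-sym (away-from-w₁ nj y)))

  φ-injective : ∀ {i j} → φ i ≡ φ j → i ≡ j
  φ-injective {i} {j} eq with i ≟ A.component w₁ | j ≟ A.component w₁
  ... | yes p | yes q = trans p (sym q)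
  ... | no ni | no nj = off-w₁ ni nj (suc-injective eq)
  φ-injective () | yes _ | no _
  φ-injective () | no _  | yes _

Reach-⊆-insert : ∀ {G : Graph} {A B : EdgeSet G} {e} →
  (∀ e′ → B e′ ≡ true → A e′ ≡ true ⊎ e′ ≡ e) → ∀ {u v} → Reach G B u v →
  Reach G A u v ⊎ (Near G A (end₁ G e) (end₂ G e) u × Near G A (end₁ G e) (end₂ G e) v)
Reach-⊆-insert B⊆A+e here = inj₁ here
Reach-⊆-insert B⊆A+e (step₁ e′ p r) with B⊆A+e e′ p | Reach-⊆-insert B⊆A+e r
... | inj₁ a       | inj₁ x       = inj₁ (step₁ e′ a x)
... | inj₁ a       | inj₂ (x , y) = inj₂ (Sum.map (step₁ e′ a) (step₁ e′ a) x , y)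
... | inj₂ refl    | inj₁ x       = inj₂ (inj₂ here , inj₁ (Reach-sym x))
... | inj₂ refl    | inj₂ (x , y) = inj₂ (inj₂ here , y)
Reach-⊆-insert B⊆A+e (step₂ e′ p r) with B⊆A+e e′ p | Reach-⊆-insert B⊆A+e r
... | inj₁ a       | inj₁ x       = inj₁ (step₂ e′ a x)
... | inj₁ a       | inj₂ (x , y) = inj₂ (Sum.map (step₂ e′ a) (step₂ e′ a) x , y)
... | inj₂ refl    | inj₁ x       = inj₂ (inj₁ here , inj₂ (Reach-sym x))
... | inj₂ refl    | inj₂ (x , y) = inj₂ (inj₁ here , y)

remove : ∀ {k} → (Fin k → Bool) → Fin k → Fin k → Bool
remove A e e′ = if does (e′ ≟ e) then false else A e′

remove-⊆-insert : ∀ {k} (A : Fin k → Bool) e e′ → A e′ ≡ true → remove A e e′ ≡ true ⊎ e′ ≡ e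
remove-⊆-insert A e e′ p with e′ ≟ e
... | yes e′≡e = inj₂ e′≡e
... | no  _    = inj₁ p

count-suc⇒remove : ∀ k (A : Fin k → Bool) s → countFin k (λ j → [ A j ]) ≡ suc s →
  Σ (Fin k) λ e → A e ≡ true × countFin k (λ j → [ remove A e j ]) ≡ s
count-suc⇒remove (suc k) A s eq with A zero in A₀
... | true  = zero , A₀ , ℕ.suc-injective eq
... | false with count-suc⇒remove k (λ j → A (suc j)) s eq
...   | e , p , q = suc e , p , q

count-zero⇒empty : ∀ k (A : Fin k → Bool) → countFin k (λ j → [ A j ]) ≡ 0 → ∀ e → A e ≡ false
count-zero⇒empty (suc k) A eq e with A zero in A₀
count-zero⇒empty (suc k) A eq zero    | false = A₀
count-zero⇒empty (suc k) A eq (suc e) | false = count-zero⇒empty k (λ j → A (suc j)) eq e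

-- r(A) ≤ |A|: deleting an edge creates at most one new component.
vertices≤components+size : ∀ (G : Graph) (k : EdgeSet G → ℕ) → (∀ A → NumComponents G A (k A)) →
  ∀ A → n G ≤ k A ℕ.+ size G A
vertices≤components+size G k N A = go (size G A) A refl
  where
  go : ∀ s A → size G A ≡ s → n G ≤ k A ℕ.+ s
  go zero    A eq = ℕ.≤-trans (vertices≤components-of-empty (count-zero⇒empty (m G) A eq) (N A)) (ℕ.m≤m+n (k A) 0)
  go (suc s) A eq with count-suc⇒remove (m G) A s eq
  ... | e , p , q = begin
    n G                     ≤⟨ go s (remove A e) q ⟩
    k (remove A e) ℕ.+ s    ≤⟨ ℕ.+-monoˡ-≤ s (components-merge (N (remove A e)) (N A) (Reach-⊆-insert (remove-⊆-insert A e))) ⟩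
    suc (k A) ℕ.+ s         ≡⟨ ℕ.+-suc (k A) s ⟨
    k A ℕ.+ suc s           ∎
    where open ℕ.≤-Reasoning

∸-telescope : ∀ {r R m s c} → r ≤ R → R ≤ m → r ≤ s → s ℕ.+ c ≡ m → (m ∸ R) ℕ.+ (R ∸ r) ≡ c ℕ.+ (s ∸ r)
∸-telescope {r} {R} {m} {s} {c} r≤R R≤m r≤s s+c≡m = begin
  (m ∸ R) ℕ.+ (R ∸ r)   ≡⟨ ℕ.+-∸-assoc (m ∸ R) r≤R ⟨
  (m ∸ R) ℕ.+ R ∸ r     ≡⟨ cong (_∸ r) (ℕ.m∸n+n≡m R≤m) ⟩
  m ∸ r                 ≡⟨ cong (_∸ r) (trans (sym s+c≡m) (ℕ.+-comm s c)) ⟩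
  c ℕ.+ s ∸ r           ≡⟨ ℕ.+-∸-assoc c r≤s ⟩
  c ℕ.+ (s ∸ r)         ∎
  where open ≡-Reasoning

+-∸-rank : ∀ {k n s} → k ≤ n → n ∸ k ≤ s → n ℕ.+ (s ∸ (n ∸ k)) ≡ s ℕ.+ k
+-∸-rank {k} {n} {s} k≤n r≤s = begin
  n ℕ.+ (s ∸ r)            ≡⟨ cong (ℕ._+ (s ∸ r)) (ℕ.m∸n+n≡m k≤n) ⟨
  (r ℕ.+ k) ℕ.+ (s ∸ r)    ≡⟨ ℕ.+-comm (r ℕ.+ k) (s ∸ r) ⟩
  (s ∸ r) ℕ.+ (r ℕ.+ k)    ≡⟨ ℕ.+-assoc (s ∸ r) r k ⟨
  (s ∸ r) ℕ.+ r ℕ.+ k      ≡⟨ cong (ℕ._+ k) (ℕ.m∸n+n≡m r≤s) ⟩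
  s ℕ.+ k                  ∎
  where
  open ≡-Reasoning
  r = n ∸ k

-- These make the truncated subtractions in the exponents of the Tutte subset expansion
-- genuine differences.
module _ (G : Graph) (k : EdgeSet G → ℕ) (N : ∀ A → NumComponents G A (k A)) where

  rank≤size : ∀ A → rank G k A ≤ size G A
  rank≤size A = ℕ.m≤n+o⇒m∸n≤o (n G) (k A) (vertices≤components+size G k N A)

  rank≤rank-allE : ∀ A → rank G k A ≤ rank G k (allE G k)
  rank≤rank-allE A = ℕ.∸-monoʳ-≤ (n G) (components-antitone (N A) (N (allE G k)) (Reach-mono (λ _ _ → refl)))

  rank-allE≤edges : rank G k (allE G k) ≤ m G
  rank-allE≤edges = ℕ.≤-trans (rank≤size (allE G k)) (ℕ.≤-reflexive size-allE)
    where
    size-allE : size G (allE G k) ≡ m G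
    size-allE = trans (countFin-const (m G) 1) (ℕ.*-identityʳ (m G))

module _ (G : Graph) {q : ℕ} where

  monochromatic : (Fin (n G) → Fin q) → Fin (m G) → Bool
  monochromatic X e = does (X (end₁ G e) ≟ X (end₂ G e))

  monochromaticOn : EdgeSet G → (Fin (n G) → Fin q) → Bool
  monochromaticOn A X = allFin (m G) (λ e → if A e then monochromatic X e else true)

  monochromaticOn-edge : ∀ {A} X → monochromaticOn A X ≡ true → ∀ e → A e ≡ true → X (end₁ G e) ≡ X (end₂ G e)
  monochromaticOn-edge {A} X mono e p with allFin-lookup (m G) _ mono e
  ... | mono-e rewrite p = ≟-true⇒≡ mono-e

  monochromaticOn⇒Reach-≡ : ∀ {A} X → monochromaticOn A X ≡ true → ∀ {u v} → Reach G A u v → X u ≡ X v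
  monochromaticOn⇒Reach-≡ X mono here          = refl
  monochromaticOn⇒Reach-≡ X mono (step₁ e p r) =
    trans (sym (monochromaticOn-edge X mono e p)) (monochromaticOn⇒Reach-≡ X mono r)
  monochromaticOn⇒Reach-≡ X mono (step₂ e p r) =
    trans (monochromaticOn-edge X mono e p) (monochromaticOn⇒Reach-≡ X mono r)

  prodFin-monochromatic : ∀ A X →
    prodFin (m G) (λ e → if A e then 𝟙 (monochromatic X e) else 1ℚ) ≡ 𝟙 (monochromaticOn A X)
  prodFin-monochromatic A X = trans (prodFin-cong (m G) (λ e → 𝟙-if (A e))) (prodFin-𝟙 (m G) _)
    where
    𝟙-if : ∀ a {b} → (if a then 𝟙 b else 1ℚ) ≡ 𝟙 (if a then b else true)
    𝟙-if true  = refl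
    𝟙-if false = refl

-- A colouring is constant on the components of (V, A) iff it factors, necessarily uniquely,
-- through the component labelling; so there are q^k of them.
module _ {G : Graph} {q : ℕ} {A : EdgeSet G} {k : ℕ} (N : NumComponents G A k) where
  open Components N

  factorsThrough : (Fin (n G) → Fin q) → (Fin k → Fin q) → Bool
  factorsThrough X g = allFin (n G) (λ v → does (g (component v) ≟ X v))

  restrictsTo : (Fin (n G) → Fin q) → (Fin k → Fin q) → Bool
  restrictsTo X g = allFin k (λ i → does (X (representative i) ≟ g i))

  factorsThrough-≡ : ∀ X g → factorsThrough X g ≡ monochromaticOn G A X ∧ restrictsTo X g
  factorsThrough-≡ X g = bool-ext to from
    where
    to : factorsThrough X g ≡ true → monochromaticOn G A X ∧ restrictsTo X g ≡ true
    to h = cong₂ _∧_ (allFin-tabulate (m G) _ mono) (allFin-tabulate k _ λ i → dec-true (_ ≟ _) (restrict i))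
      where
      X≡g∘c : ∀ v → g (component v) ≡ X v
      X≡g∘c v = ≟-true⇒≡ (allFin-lookup (n G) _ h v)
      mono : ∀ e → (if A e then monochromatic G X e else true) ≡ true
      mono e with A e in Ae
      ... | true  = dec-true (_ ≟ _) (trans (sym (X≡g∘c (end₁ G e)))
                    (trans (cong g (Reach⇒same (step₂ e Ae here))) (X≡g∘c (end₂ G e))))
      ... | false = refl
      restrict : ∀ i → X (representative i) ≡ g i
      restrict i = trans (sym (X≡g∘c (representative i))) (cong g (component-representative i))
    from : monochromaticOn G A X ∧ restrictsTo X g ≡ true → factorsThrough X g ≡ true
    from h with monochromaticOn G A X in mono
    ... | true = allFin-tabulate (n G) _ λ v → dec-true (_ ≟ _)
      (trans (sym (≟-true⇒≡ (allFin-lookup k _ h (component v))))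
             (monochromaticOn⇒Reach-≡ G X mono (Reach-representative v)))

  sum-factorsThrough-over-maps : ∀ X → sumMaps q k (λ g → 𝟙 (factorsThrough X g)) ≡ 𝟙 (monochromaticOn G A X)
  sum-factorsThrough-over-maps X = begin
    sumMaps q k (λ g → 𝟙 (factorsThrough X g))
      ≡⟨ Σk.ext (λ g → trans (cong 𝟙 (factorsThrough-≡ X g)) (𝟙-∧ mono (restrictsTo X g))) ⟩
    sumMaps q k (λ g → 𝟙 mono * 𝟙 (restrictsTo X g))
      ≡⟨ Σk.homogeneous (𝟙 mono) _ ⟩
    𝟙 mono * sumMaps q k (λ g → 𝟙 (restrictsTo X g))
      ≡⟨ cong (𝟙 mono *_) (trans (Σk.ext (λ g → sym (prodFin-𝟙 k _))) (sumMaps-point q k (X ∘ representative))) ⟩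
    𝟙 mono * 1ℚ
      ≡⟨ ℚ.*-identityʳ (𝟙 mono) ⟩
    𝟙 mono ∎
    where
    open ≡-Reasoning
    module Σk = Linear (sumMaps-linear q k)
    mono = monochromaticOn G A X

  sum-factorsThrough-over-colourings : ∀ g → sumMaps q (n G) (λ X → 𝟙 (factorsThrough X g)) ≡ 1ℚ
  sum-factorsThrough-over-colourings g =
    trans (ext (sumMaps-linear q (n G)) (λ X → sym (prodFin-𝟙 (n G) _))) (sumMaps-point q (n G) (g ∘ component))

  sumMaps-monochromaticOn : sumMaps q (n G) (λ X → 𝟙 (monochromaticOn G A X)) ≡ ℕ→ℚ q ^ k
  sumMaps-monochromaticOn = begin
    sumMaps q (n G) (λ X → 𝟙 (monochromaticOn G A X))
      ≡⟨ ext (sumMaps-linear q (n G)) (λ X → sym (sum-factorsThrough-over-maps X)) ⟩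
    sumMaps q (n G) (λ X → sumMaps q k (λ g → 𝟙 (factorsThrough X g)))
      ≡⟨ sumMaps-fubini q (n G) (sumMaps q k) (sumMaps-linear q k) (λ X g → 𝟙 (factorsThrough X g)) ⟩
    sumMaps q k (λ g → sumMaps q (n G) (λ X → 𝟙 (factorsThrough X g)))
      ≡⟨ ext (sumMaps-linear q k) sum-factorsThrough-over-colourings ⟩
    sumMaps q k (λ _ → 1ℚ)
      ≡⟨ sumMaps-one q k ⟩
    ℕ→ℚ q ^ k ∎
    where open ≡-Reasoning

tutte-monomial : ∀ {D y Q : ℚ} → D * y ≡ Q → ∀ {n a b c j s k} → a ℕ.+ b ≡ c ℕ.+ j → n ℕ.+ j ≡ s ℕ.+ k →
  Q ^ n * (D ^ a * (D ^ b * y ^ j)) ≡ D ^ c * (Q ^ s * Q ^ k)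
tutte-monomial {D} {y} {Q} Dy≡Q {n} {a} {b} {c} {j} {s} {k} a+b≡c+j n+j≡s+k = begin
  Q ^ n * (D ^ a * (D ^ b * y ^ j))     ≡⟨ cong (Q ^ n *_) (ℚ.*-assoc (D ^ a) (D ^ b) (y ^ j)) ⟨
  Q ^ n * (D ^ a * D ^ b * y ^ j)       ≡⟨ cong (λ z → Q ^ n * (z * y ^ j)) D^a*D^b ⟩
  Q ^ n * (D ^ c * D ^ j * y ^ j)       ≡⟨ cong (Q ^ n *_) (ℚ.*-assoc (D ^ c) (D ^ j) (y ^ j)) ⟩
  Q ^ n * (D ^ c * (D ^ j * y ^ j))     ≡⟨ cong (λ z → Q ^ n * (D ^ c * z)) (trans (sym (^-distribʳ-* D y j)) (cong (_^ j) Dy≡Q)) ⟩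
  Q ^ n * (D ^ c * Q ^ j)               ≡⟨ ℚ*.x∙yz≈y∙xz (Q ^ n) (D ^ c) (Q ^ j) ⟩
  D ^ c * (Q ^ n * Q ^ j)               ≡⟨ cong (D ^ c *_) Q^n*Q^j ⟩
  D ^ c * (Q ^ s * Q ^ k)               ∎
  where
  open ≡-Reasoning
  D^a*D^b : D ^ a * D ^ b ≡ D ^ c * D ^ j
  D^a*D^b = trans (sym (^-distribˡ-+-* D a b)) (trans (cong (D ^_) a+b≡c+j) (^-distribˡ-+-* D c j))
  Q^n*Q^j : Q ^ n * Q ^ j ≡ Q ^ s * Q ^ k
  Q^n*Q^j = trans (sym (^-distribˡ-+-* Q n j)) (trans (cong (Q ^_) n+j≡s+k) (^-distribˡ-+-* Q s k))

module _ (G : Graph) {q : ℕ} (X : Fin (n G) → Fin q) (Y : Fin (m G) → Fin q) where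

  #agree+#disagree : #agree G X Y ℕ.+ #disagree G X Y ≡ 2 ℕ.* m G
  #agree+#disagree = trans (sym (countFin-+ (m G) _ _))
    (trans (countFin-cong (m G) (λ e → two (does (X (end₁ G e) ≟ Y e)) (does (X (end₂ G e) ≟ Y e))))
    (trans (countFin-const (m G) 2) (ℕ.*-comm (m G) 2)))
    where
    two : ∀ b₁ b₂ → [ b₁ ] ℕ.+ [ b₂ ] ℕ.+ ([ not b₁ ] ℕ.+ [ not b₂ ]) ≡ 2
    two true  true  = refl
    two true  false = refl
    two false true  = refl
    two false false = refl

  #agree≡countFin-#at : #agree G X Y ≡ countFin (n G) (λ v → #at G Y v (X v))
  #agree≡countFin-#at = sym (begin
    countFin (n G) (λ v → #at G Y v (X v))
      ≡⟨ countFin-swap (n G) (m G) _ ⟩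
    countFin (m G) (λ e → countFin (n G) (λ v → at₁ e v ℕ.+ at₂ e v))
      ≡⟨ countFin-cong (m G) (λ e → countFin-+ (n G) (at₁ e) (at₂ e)) ⟩
    countFin (m G) (λ e → countFin (n G) (at₁ e) ℕ.+ countFin (n G) (at₂ e))
      ≡⟨ countFin-cong (m G) (λ e → cong₂ ℕ._+_ (agrees-at (end₁ G) e) (agrees-at (end₂ G) e)) ⟩
    #agree G X Y ∎)
    where
    open ≡-Reasoning
    at₁ at₂ : Fin (m G) → Fin (n G) → ℕ
    at₁ e v = [ does (end₁ G e ≟ v) ∧ does (Y e ≟ X v) ]
    at₂ e v = [ does (end₂ G e ≟ v) ∧ does (Y e ≟ X v) ]
    agrees-at : ∀ (end : Fin (m G) → Fin (n G)) e →
      countFin (n G) (λ v → [ does (end e ≟ v) ∧ does (Y e ≟ X v) ]) ≡ [ does (X (end e) ≟ Y e) ]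
    agrees-at end e = trans (countFin-δ (n G) (end e) (λ v → does (Y e ≟ X v))) (cong [_] (≟-sym (Y e) (X (end e))))

  agreement-weight : ∀ (t Q : ℚ) → (t + Q) ^ #agree G X Y * t ^ #disagree G X Y
    ≡ prodFin (m G) (λ e → (t + Q * 𝟙 (does (X (end₁ G e) ≟ Y e))) * (t + Q * 𝟙 (does (X (end₂ G e) ≟ Y e))))
  agreement-weight t Q =
    trans (cong₂ _*_ (^-countFin (t + Q) (m G) _) (^-countFin t (m G) _))
    (trans (sym (prodFin-* (m G) _ _))
    (prodFin-cong (m G) (λ e → per-edge (does (X (end₁ G e) ≟ Y e)) (does (X (end₂ G e) ≟ Y e)))))
    where
    per-edge : ∀ b₁ b₂ → (t + Q) ^ ([ b₁ ] ℕ.+ [ b₂ ]) * t ^ ([ not b₁ ] ℕ.+ [ not b₂ ])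
                        ≡ (t + Q * 𝟙 b₁) * (t + Q * 𝟙 b₂)
    per-edge true  true  = solve 2 (λ t Q → ((t :+ Q) :* ((t :+ Q) :* con 1ℚ)) :* con 1ℚ
                                            := (t :+ Q :* con 1ℚ) :* (t :+ Q :* con 1ℚ)) refl t Q
    per-edge true  false = solve 2 (λ t Q → ((t :+ Q) :* con 1ℚ) :* (t :* con 1ℚ)
                                            := (t :+ Q :* con 1ℚ) :* (t :+ Q :* con 0ℚ)) refl t Q
    per-edge false true  = solve 2 (λ t Q → ((t :+ Q) :* con 1ℚ) :* (t :* con 1ℚ)
                                            := (t :+ Q :* con 0ℚ) :* (t :+ Q :* con 1ℚ)) refl t Q
    per-edge false false = solve 2 (λ t Q → con 1ℚ :* (t :* (t :* con 1ℚ))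
                                            := (t :+ Q :* con 0ℚ) :* (t :+ Q :* con 0ℚ)) refl t Q

sumFin-edge-weight : ∀ q (t : ℚ) (a b : Fin q) →
  sumFin q (λ c → (t + ℕ→ℚ q * 𝟙 (does (a ≟ c))) * (t + ℕ→ℚ q * 𝟙 (does (b ≟ c))))
  ≡ ℕ→ℚ q * (t * t + (t + t) + ℕ→ℚ q * 𝟙 (does (a ≟ b)))
sumFin-edge-weight q t a b = begin
  sumFin q (λ c → (t + Q * δa c) * (t + Q * δb c))
    ≡⟨ sumFin-cong q (λ c → expand (δa c) (δb c)) ⟩
  sumFin q (λ c → t * t + ((Q * t) * δa c + ((Q * t) * δb c + (Q * Q) * (δa c * δb c))))
    ≡⟨ sumFin-+ q _ _ ⟩
  sumFin q (λ _ → t * t) + sumFin q (λ c → (Q * t) * δa c + ((Q * t) * δb c + (Q * Q) * (δa c * δb c)))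
    ≡⟨ cong₂ _+_ (sumFin-const q (t * t)) (trans (sumFin-+ q _ _) (cong (∑ (λ c → (Q * t) * δa c) +_) (sumFin-+ q _ _))) ⟩
  Q * (t * t) + (∑ (λ c → (Q * t) * δa c) + (∑ (λ c → (Q * t) * δb c) + ∑ (λ c → (Q * Q) * (δa c * δb c))))
    ≡⟨ cong (Q * (t * t) +_) (cong₂ _+_ (sumFin-* q (Q * t) δa) (cong₂ _+_ (sumFin-* q (Q * t) δb) (sumFin-* q (Q * Q) _))) ⟩
  Q * (t * t) + ((Q * t) * ∑ δa + ((Q * t) * ∑ δb + (Q * Q) * ∑ (λ c → δa c * δb c)))
    ≡⟨ cong (Q * (t * t) +_) (cong₂ (λ x y → (Q * t) * x + ((Q * t) * y + (Q * Q) * ∑ (λ c → δa c * δb c)))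
         (sumFin-δ-one q a) (sumFin-δ-one q b)) ⟩
  Q * (t * t) + ((Q * t) * 1ℚ + ((Q * t) * 1ℚ + (Q * Q) * ∑ (λ c → δa c * δb c)))
    ≡⟨ cong (λ z → Q * (t * t) + ((Q * t) * 1ℚ + ((Q * t) * 1ℚ + (Q * Q) * z)))
         (trans (sumFin-δ q a δb) (cong 𝟙 (≟-sym b a))) ⟩
  Q * (t * t) + ((Q * t) * 1ℚ + ((Q * t) * 1ℚ + (Q * Q) * δab))
    ≡⟨ solve 3 (λ Q t δ → Q :* (t :* t) :+ ((Q :* t) :* con 1ℚ :+ ((Q :* t) :* con 1ℚ :+ (Q :* Q) :* δ))
                          := Q :* (t :* t :+ (t :+ t) :+ Q :* δ)) refl Q t δab ⟩
  Q * (t * t + (t + t) + Q * δab) ∎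
  where
  open ≡-Reasoning
  Q = ℕ→ℚ q
  ∑ : (Fin q → ℚ) → ℚ
  ∑ = sumFin q
  δa δb : Fin q → ℚ
  δa c = 𝟙 (does (a ≟ c))
  δb c = 𝟙 (does (b ≟ c))
  δab = 𝟙 (does (a ≟ b))
  expand : ∀ x y → (t + Q * x) * (t + Q * y) ≡ t * t + ((Q * t) * x + ((Q * t) * y + (Q * Q) * (x * y)))
  expand x y = solve 4 (λ t Q x y → (t :+ Q :* x) :* (t :+ Q :* y)
                         := t :* t :+ ((Q :* t) :* x :+ ((Q :* t) :* y :+ (Q :* Q) :* (x :* y)))) refl t Q x y

module HalfEdgeWeights (G : Graph) (q : ℕ) .{{_ : NonZero q}} (s : ℚ)
                       .{{_ : ℚ.NonZero (s * s - 1ℚ)}} .{{_ : ℚ.NonZero (s - 1ℚ)}} where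

  t Q D W : ℚ
  t = s - 1ℚ
  Q = ℕ→ℚ q
  D = s * s - 1ℚ
  W = (t + Q) ÷ t

  weight : (Fin (n G) → Fin q) → (Fin (m G) → Fin q) → ℚ
  weight X Y = (t + Q) ^ #agree G X Y * t ^ #disagree G X Y

  D≡t²+2t : D ≡ t * t + (t + t)
  D≡t²+2t = solve 1 (λ s → s :* s :- con 1ℚ := (s :- con 1ℚ) :* (s :- con 1ℚ) :+ ((s :- con 1ℚ) :+ (s :- con 1ℚ))) refl s

  sum-over-edge-colourings : ∀ X →
    sumMaps q (m G) (weight X) ≡ Q ^ m G * prodFin (m G) (λ e → D + Q * 𝟙 (monochromatic G X e))
  sum-over-edge-colourings X = begin
    sumMaps q (m G) (weight X)
      ≡⟨ ext (sumMaps-linear q (m G)) (λ Y → agreement-weight G X Y t Q) ⟩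
    sumMaps q (m G) (λ Y → prodFin (m G) (λ e → h e (Y e)))
      ≡⟨ sumFun-prodFin (sumFin-linear q) (m G) h ⟩
    prodFin (m G) (λ e → sumFin q (h e))
      ≡⟨ prodFin-cong (m G) (λ e → trans (sumFin-edge-weight q t (X (end₁ G e)) (X (end₂ G e)))
           (cong (λ d → Q * (d + Q * 𝟙 (monochromatic G X e))) (sym D≡t²+2t))) ⟩
    prodFin (m G) (λ e → Q * (D + Q * 𝟙 (monochromatic G X e)))
      ≡⟨ prodFin-* (m G) (λ _ → Q) _ ⟩
    prodFin (m G) (λ _ → Q) * prodFin (m G) (λ e → D + Q * 𝟙 (monochromatic G X e))
      ≡⟨ cong (_* prodFin (m G) (λ e → D + Q * 𝟙 (monochromatic G X e))) (prodFin-const (m G) Q) ⟩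
    Q ^ m G * prodFin (m G) (λ e → D + Q * 𝟙 (monochromatic G X e)) ∎
    where
    open ≡-Reasoning
    h : Fin (m G) → Fin q → ℚ
    h e c = (t + Q * 𝟙 (does (X (end₁ G e) ≟ c))) * (t + Q * 𝟙 (does (X (end₂ G e) ≟ c)))

  module _ (k : EdgeSet G → ℕ) (N : ∀ A → NumComponents G A (k A)) where

    #outside : EdgeSet G → ℕ
    #outside A = countFin (m G) (λ e → [ not (A e) ])

    subgraph-term : EdgeSet G → ℚ
    subgraph-term A = D ^ #outside A * (Q ^ size G A * Q ^ k A)

    sumMaps-subgraph-product : ∀ A →
      sumMaps q (n G) (λ X → prodFin (m G) (λ e → if A e then Q * 𝟙 (monochromatic G X e) else D)) ≡ subgraph-term A
    sumMaps-subgraph-product A = begin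
      ΣX (λ X → prodFin (m G) (λ e → if A e then Q * 𝟙 (monochromatic G X e) else D))
        ≡⟨ ext (sumMaps-linear q (n G)) (λ X → prodFin-if (m G) A Q D _) ⟩
      ΣX (λ X → D ^ #outside A * (Q ^ size G A * prodFin (m G) (λ e → if A e then 𝟙 (monochromatic G X e) else 1ℚ)))
        ≡⟨ homogeneous (sumMaps-linear q (n G)) (D ^ #outside A) _ ⟩
      D ^ #outside A * ΣX (λ X → Q ^ size G A * prodFin (m G) (λ e → if A e then 𝟙 (monochromatic G X e) else 1ℚ))
        ≡⟨ cong (D ^ #outside A *_) (homogeneous (sumMaps-linear q (n G)) (Q ^ size G A) _) ⟩
      D ^ #outside A * (Q ^ size G A * ΣX (λ X → prodFin (m G) (λ e → if A e then 𝟙 (monochromatic G X e) else 1ℚ)))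
        ≡⟨ cong (λ z → D ^ #outside A * (Q ^ size G A * z))
             (trans (ext (sumMaps-linear q (n G)) (prodFin-monochromatic G A)) (sumMaps-monochromaticOn (N A))) ⟩
      subgraph-term A ∎
      where
      open ≡-Reasoning
      ΣX = sumMaps q (n G)

    sum-of-weights : sumMaps q (n G) (λ X → sumMaps q (m G) (weight X)) ≡ Q ^ m G * sumFun sumBool (m G) subgraph-term
    sum-of-weights = begin
      ΣX (λ X → sumMaps q (m G) (weight X))
        ≡⟨ ext (sumMaps-linear q (n G)) sum-over-edge-colourings ⟩
      ΣX (λ X → Q ^ m G * prodFin (m G) (λ e → D + Q * 𝟙 (monochromatic G X e)))
        ≡⟨ homogeneous (sumMaps-linear q (n G)) (Q ^ m G) _ ⟩
      Q ^ m G * ΣX (λ X → prodFin (m G) (λ e → D + Q * 𝟙 (monochromatic G X e)))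
        ≡⟨ cong (Q ^ m G *_) (ext (sumMaps-linear q (n G)) (λ X → prodFin-+ (m G) (λ _ → D) _)) ⟩
      Q ^ m G * ΣX (λ X → ΣA (λ A → prodFin (m G) (λ e → if A e then Q * 𝟙 (monochromatic G X e) else D)))
        ≡⟨ cong (Q ^ m G *_) (sumMaps-fubini q (n G) ΣA (sumFun-linear sumBool-linear (m G)) _) ⟩
      Q ^ m G * ΣA (λ A → ΣX (λ X → prodFin (m G) (λ e → if A e then Q * 𝟙 (monochromatic G X e) else D)))
        ≡⟨ cong (Q ^ m G *_) (ext (sumFun-linear sumBool-linear (m G)) sumMaps-subgraph-product) ⟩
      Q ^ m G * ΣA subgraph-term ∎
      where
      open ≡-Reasoning
      ΣX = sumMaps q (n G)
      ΣA = sumFun sumBool (m G)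

    lhs : ℚ
    lhs = D ^ (m G ∸ rank G k (allE G k)) * tutte G k (s * s) ((D + Q) ÷ D)

    D*[y-1]≡Q : D * ((D + Q) ÷ D - 1ℚ) ≡ Q
    D*[y-1]≡Q = begin
      D * (z - 1ℚ)  ≡⟨ solve 2 (λ d z → d :* (z :- con 1ℚ) := z :* d :- d) refl D z ⟩
      z * D - D     ≡⟨ cong (_- D) (÷-*-cancel (D + Q) D) ⟩
      D + Q - D     ≡⟨ solve 2 (λ d Q → d :+ Q :- d := Q) refl D Q ⟩
      Q             ∎
      where
      open ≡-Reasoning
      z = (D + Q) ÷ D

    tutte-as-subgraph-sum : Q ^ n G * lhs ≡ sumFun sumBool (m G) subgraph-term
    tutte-as-subgraph-sum =
      trans (cong (Q ^ n G *_) (sym (homogeneous ΣA-linear (D ^ (m G ∸ rank G k (allE G k))) _)))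
      (trans (sym (homogeneous ΣA-linear (Q ^ n G) _))
      (ext ΣA-linear term))
      where
      ΣA-linear = sumFun-linear sumBool-linear (m G)
      R = rank G k (allE G k)
      term : ∀ A → Q ^ n G * (D ^ (m G ∸ R) * (D ^ (R ∸ rank G k A)
                     * ((D + Q) ÷ D - 1ℚ) ^ (size G A ∸ rank G k A))) ≡ subgraph-term A
      term A = tutte-monomial D*[y-1]≡Q {n = n G} {a = m G ∸ R} {b = R ∸ rank G k A} {c = #outside A}
                                        {s = size G A} {k = k A}
        (∸-telescope (rank≤rank-allE G k N A) (rank-allE≤edges G k N) (rank≤size G k N A) (count+count-not (m G) A))
        (+-∸-rank (components≤vertices (N A)) (rank≤size G k N A))

    tutte≡expectation : lhs ≡ 𝔼 G q weight
    tutte≡expectation = sym (begin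
      invPow q (n G ℕ.+ m G) * sumMaps q (n G) (λ X → sumMaps q (m G) (weight X))
        ≡⟨ cong (invPow q (n G ℕ.+ m G) *_) (trans sum-of-weights (cong (Q ^ m G *_) (sym tutte-as-subgraph-sum))) ⟩
      invPow q (n G ℕ.+ m G) * (Q ^ m G * (Q ^ n G * lhs))
        ≡⟨ solve 4 (λ i a b l → i :* (b :* (a :* l)) := (i :* (a :* b)) :* l) refl (invPow q (n G ℕ.+ m G)) (Q ^ n G) (Q ^ m G) lhs ⟩
      invPow q (n G ℕ.+ m G) * (Q ^ n G * Q ^ m G) * lhs
        ≡⟨ cong (λ z → invPow q (n G ℕ.+ m G) * z * lhs) (^-distribˡ-+-* Q (n G) (m G)) ⟨
      invPow q (n G ℕ.+ m G) * Q ^ (n G ℕ.+ m G) * lhs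
        ≡⟨ cong (_* lhs) (invPow-inverseˡ q (n G ℕ.+ m G)) ⟩
      1ℚ * lhs
        ≡⟨ ℚ.*-identityˡ lhs ⟩
      lhs ∎)
      where open ≡-Reasoning

  weight-by-vertices : ∀ X Y → weight X Y ≡ t ^ (2 ℕ.* m G) * prodFin (n G) (λ v → W ^ #at G Y v (X v))
  weight-by-vertices X Y = begin
    (t + Q) ^ ag * t ^ dis        ≡⟨ cong (λ z → z ^ ag * t ^ dis) (÷-*-cancel (t + Q) t) ⟨
    (W * t) ^ ag * t ^ dis        ≡⟨ cong (_* t ^ dis) (^-distribʳ-* W t ag) ⟩
    W ^ ag * t ^ ag * t ^ dis     ≡⟨ ℚ.*-assoc (W ^ ag) (t ^ ag) (t ^ dis) ⟩
    W ^ ag * (t ^ ag * t ^ dis)   ≡⟨ cong (W ^ ag *_) (trans (sym (^-distribˡ-+-* t ag dis)) (cong (t ^_) (#agree+#disagree G X Y))) ⟩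
    W ^ ag * t ^ (2 ℕ.* m G)      ≡⟨ ℚ.*-comm (W ^ ag) (t ^ (2 ℕ.* m G)) ⟩
    t ^ (2 ℕ.* m G) * W ^ ag      ≡⟨ cong (t ^ (2 ℕ.* m G) *_) (trans (cong (W ^_) (#agree≡countFin-#at G X Y)) (^-countFin W (n G) _)) ⟩
    t ^ (2 ℕ.* m G) * prodFin (n G) (λ v → W ^ #at G Y v (X v)) ∎
    where
    open ≡-Reasoning
    ag = #agree G X Y
    dis = #disagree G X Y

  sum-over-vertex-colourings : ∀ Y → sumMaps q (n G) (λ X → weight X Y)
    ≡ t ^ (2 ℕ.* m G) * prodFin (n G) (λ v → sumFin q (λ a → W ^ #at G Y v a))
  sum-over-vertex-colourings Y =
    trans (ext (sumMaps-linear q (n G)) (λ X → weight-by-vertices X Y))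
    (trans (homogeneous (sumMaps-linear q (n G)) (t ^ (2 ℕ.* m G)) _)
    (cong (t ^ (2 ℕ.* m G) *_) (sumFun-prodFin (sumFin-linear q) (n G) (λ v a → W ^ #at G Y v a))))

  expectation-by-vertices : 𝔼 G q weight ≡ invPow q (m G ℕ.+ n G) * t ^ (2 ℕ.* m G)
    * sumMaps q (m G) (λ Y → prodFin (n G) (λ v → sumFin q (λ a → W ^ #at G Y v a)))
  expectation-by-vertices = begin
    invPow q (n G ℕ.+ m G) * sumMaps q (n G) (λ X → sumMaps q (m G) (weight X))
      ≡⟨ cong (invPow q (n G ℕ.+ m G) *_) (sumMaps-fubini q (n G) (sumMaps q (m G)) (sumMaps-linear q (m G)) weight) ⟩
    invPow q (n G ℕ.+ m G) * sumMaps q (m G) (λ Y → sumMaps q (n G) (λ X → weight X Y))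
      ≡⟨ cong (invPow q (n G ℕ.+ m G) *_) (trans (ext (sumMaps-linear q (m G)) sum-over-vertex-colourings)
           (homogeneous (sumMaps-linear q (m G)) (t ^ (2 ℕ.* m G)) _)) ⟩
    invPow q (n G ℕ.+ m G) * (t ^ (2 ℕ.* m G) * S)
      ≡⟨ ℚ.*-assoc (invPow q (n G ℕ.+ m G)) (t ^ (2 ℕ.* m G)) S ⟨
    invPow q (n G ℕ.+ m G) * t ^ (2 ℕ.* m G) * S
      ≡⟨ cong (λ j → invPow q j * t ^ (2 ℕ.* m G) * S) (ℕ.+-comm (n G) (m G)) ⟩
    invPow q (m G ℕ.+ n G) * t ^ (2 ℕ.* m G) * S ∎
    where
    open ≡-Reasoning
    S = sumMaps q (m G) (λ Y → prodFin (n G) (λ v → sumFin q (λ a → W ^ #at G Y v a)))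

corollary3p5 :
    (G : Graph) (q : ℕ) .{{_ : NonZero q}}
    (k : EdgeSet G → ℕ) → (∀ A → NumComponents G A (k A)) →
    (s : ℚ) .{{_ : ℚ.NonZero (s * s - 1ℚ)}} .{{_ : ℚ.NonZero (s - 1ℚ)}} →
    let lhs = ((s * s - 1ℚ) ^ (m G ∸ rank G k (allE G k)))
              * tutte G k (s * s) ((s * s - 1ℚ + ℕ→ℚ q) ÷ (s * s - 1ℚ))
    in
    (lhs ≡ 𝔼 G q (λ X Y → ((s - 1ℚ + ℕ→ℚ q) ^ #agree G X Y)
                          * ((s - 1ℚ) ^ #disagree G X Y)))
    ×
    (lhs ≡ invPow q (m G ℕ.+ n G) * ((s - 1ℚ) ^ (2 ℕ.* m G))
           * sumMaps q (m G) (λ y → prodFin (n G) (λ v →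
               sumFin q (λ a → ((s - 1ℚ + ℕ→ℚ q) ÷ (s - 1ℚ)) ^ #at G y v a))))
corollary3p5 G q k N s = tutte≡expectation k N , trans (tutte≡expectation k N) expectation-by-vertices
  where open HalfEdgeWeights G q s
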